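{- Let $X$ be a finite connected vertex-transitive graph with at least $3$ vertices, and let $G$ be a group of automorphisms of $X$ acting transitively on $V(X)$ such that $G'$ is cyclic of order $p^k$ for a prime $p$, and such that $X$ is $G$-minimal. If $H$ is any subgroup of $G'$, then $H$ is normal in $G$ and $H^p \subseteq \Phi(G)$, where $H^p = \langle h^p : h \in H\rangle$.
   Context: $G'$ is the commutator subgroup of $G$. $X$ is $G$-minimal if whenever $Y$ is a connected spanning subgraph of $X$ with $gY = Y$ for all $g\in G$, then $Y = X$. An element $g\in G$ is a nongenerator if for every subset $S\subseteq G$ with $\langle S, g\rangle = G$ one has $\langle S\rangle = G$; the Frattini subgroup $\Phi(G)$ is the set of all nongenerators. -}

module Defs where

open import Data.Nat using (ℕ; zero; suc; _<_; _≤_)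
open import Data.Bool using (Bool; true; false)
open import Data.Fin using (Fin)
open import Data.Fin.Permutation public
  using (Permutation′; _⟨$⟩ʳ_; _≈_; id; flip; _∘ₚ_)
open import Data.Nat.Primality using (Prime)
open import Data.Nat using (_^_)
open import Data.Product using (Σ; ∃; _×_; _,_)
open import Data.Sum using (_⊎_)
open import Relation.Binary.PropositionalEquality using (_≡_)
open import Relation.Nullary using (¬_)
open import Level using (suc; zero) renaming (_⊔_ to _⊔ˡ_)

record Graph (n : ℕ) : Set where
  field
    adj   : Fin n → Fin n → Bool
    sym   : ∀ u v → adj u v ≡ adj v u
    irrefl : ∀ u → adj u u ≡ false
open Graph public

data Walk {n : ℕ} (E : Fin n → Fin n → Bool) : Fin n → Fin n → Set where
  here : ∀ {u} → Walk E u u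
  step : ∀ {u v w} → E u v ≡ true → Walk E v w → Walk E u w

ConnectedRel : {n : ℕ} → (Fin n → Fin n → Bool) → Set
ConnectedRel {n} E = ∀ (u v : Fin n) → Walk E u v

Connected : {n : ℕ} → Graph n → Set
Connected X = ConnectedRel (adj X)

-- Permutations of the vertex set; group elements are compared up to
-- pointwise equality _≈_.  Product  g · h  =  "first h, then g".

Perm : ℕ → Set
Perm n = Permutation′ n

infixl 7 _·_
_·_ : {n : ℕ} → Perm n → Perm n → Perm n
g · h = h ∘ₚ g

_⁻¹ : {n : ℕ} → Perm n → Perm n
g ⁻¹ = flip g

_^ₚ_ : {n : ℕ} → Perm n → ℕ → Perm n
g ^ₚ zero = id
g ^ₚ (suc m) = g · (g ^ₚ m)

[_,_] : {n : ℕ} → Perm n → Perm n → Perm n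
[ a , b ] = a ⁻¹ · b ⁻¹ · a · b

Subset : ℕ → Set₁
Subset n = Perm n → Set

_⊆_ : {n : ℕ} → Subset n → Subset n → Set
A ⊆ B = ∀ g → A g → B g

_≐_ : {n : ℕ} → Subset n → Subset n → Set
A ≐ B = (A ⊆ B) × (B ⊆ A)

_∪_ : {n : ℕ} → Subset n → Subset n → Subset n
(A ∪ B) g = A g ⊎ B g

⟦_⟧ : {n : ℕ} → Perm n → Subset n
⟦ x ⟧ g = g ≈ x

record IsSubgroup {n : ℕ} (H : Subset n) : Set where
  field
    resp  : ∀ {g h} → g ≈ h → H g → H h
    one   : H id
    mul   : ∀ {g h} → H g → H h → H (g · h)
    inv   : ∀ {g} → H g → H (g ⁻¹)

data ⟨_⟩ {n : ℕ} (S : Subset n) : Subset n where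
  gen  : ∀ {g} → S g → ⟨ S ⟩ g
  one  : ⟨ S ⟩ id
  mul  : ∀ {g h} → ⟨ S ⟩ g → ⟨ S ⟩ h → ⟨ S ⟩ (g · h)
  inv  : ∀ {g} → ⟨ S ⟩ g → ⟨ S ⟩ (g ⁻¹)
  resp : ∀ {g h} → g ≈ h → ⟨ S ⟩ g → ⟨ S ⟩ h

Commutators : {n : ℕ} → Subset n → Subset n
Commutators G g = Σ _ λ a → Σ _ λ b → G a × G b × (g ≈ [ a , b ])

_′ : {n : ℕ} → Subset n → Subset n
G ′ = ⟨ Commutators G ⟩

HasOrder : {n : ℕ} → Perm n → ℕ → Set
HasOrder c m = (0 < m) × ((c ^ₚ m) ≈ id) × (∀ j → 0 < j → j < m → ¬ ((c ^ₚ j) ≈ id))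

CyclicOfOrder : {n : ℕ} → Subset n → ℕ → Set
CyclicOfOrder H m = Σ _ λ c → H c × (H ≐ ⟨ ⟦ c ⟧ ⟩) × HasOrder c m

NormalIn : {n : ℕ} → Subset n → Subset n → Set
NormalIn H G = ∀ g h → G g → H h → H (g · h · g ⁻¹)

PowerSet : {n : ℕ} → Subset n → ℕ → Subset n
PowerSet H p g = Σ _ λ h → H h × (g ≈ (h ^ₚ p))

_^ˢ_ : {n : ℕ} → Subset n → ℕ → Subset n
H ^ˢ p = ⟨ PowerSet H p ⟩

-- nongenerators and the Frattini subgroup Φ(G) (set of all nongenerators)
IsNongenerator : {n : ℕ} → Subset n → Perm n → Set₁
IsNongenerator {n} G g =
  G g × (∀ (S : Subset n) → S ⊆ G → ⟨ S ∪ ⟦ g ⟧ ⟩ ≐ G → ⟨ S ⟩ ≐ G)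

_⊆Φ_ : {n : ℕ} → Subset n → Subset n → Set₁
A ⊆Φ G = ∀ g → A g → IsNongenerator G g

IsAut : {n : ℕ} → Graph n → Perm n → Set
IsAut X g = ∀ u v → adj X (g ⟨$⟩ʳ u) (g ⟨$⟩ʳ v) ≡ adj X u v

IsAutGroup : {n : ℕ} → Graph n → Subset n → Set
IsAutGroup X G = IsSubgroup G × (∀ g → G g → IsAut X g)

Transitive : {n : ℕ} → Subset n → Set
Transitive {n} G = ∀ (u v : Fin n) → Σ _ λ g → G g × (g ⟨$⟩ʳ u ≡ v)

VertexTransitive : {n : ℕ} → Graph n → Set
VertexTransitive X = Transitive (IsAut X)

record SpanningSubgraph {n : ℕ} (X : Graph n) : Set where
  field
    edge    : Fin n → Fin n → Bool
    edgeSym : ∀ u v → edge u v ≡ edge v u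
    sub     : ∀ u v → edge u v ≡ true → adj X u v ≡ true
open SpanningSubgraph public

GInvariant : {n : ℕ} {X : Graph n} → Subset n → SpanningSubgraph X → Set
GInvariant G Y = ∀ g → G g → ∀ u v → edge Y (g ⟨$⟩ʳ u) (g ⟨$⟩ʳ v) ≡ edge Y u v

GMinimal : {n : ℕ} → Graph n → Subset n → Set
GMinimal X G = ∀ (Y : SpanningSubgraph X) → ConnectedRel (edge Y) → GInvariant G Y →
  ∀ u v → edge Y u v ≡ adj X u v

module Submission where

-- Since G′ = ⟨c⟩ and g⁻¹ c g = c [c , g] ∈ G′, conjugation by any g ∈ G acts on ⟨c⟩ as a
-- power map x ↦ xᵉ, so every subgroup of G′ is normal in G.  Every element of Hᵖ lies in
-- ⟨cᵖ⟩.  If ⟨S , x⟩ = G with x ∈ ⟨cᵖ⟩, then G = ⟨S⟩ ⟨cᵖ⟩ because ⟨cᵖ⟩ is normal, so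
-- c = h c^q with h ∈ ⟨S⟩ and p ∣ q.  Then h commutes with c^q, and raising to q-th powers
-- repeatedly gives c = hᵃ c^(qʳ) for every r; with r = k the second factor vanishes, so
-- c ∈ ⟨S⟩ and ⟨S⟩ = G.

open import Defs
open import Data.Nat using (ℕ; _≤_; _^_; zero; suc; _+_; _*_; _<_)
open import Data.Nat.Primality using (Prime)
open import Data.Product using (_×_; Σ; _,_)

open import Level using (0ℓ)
open import Algebra.Bundles using (Group)
open import Algebra.Structures using (IsGroup)
import Algebra.Properties.Group as GroupProperties
import Algebra.Properties.Quasigroup as QuasigroupProperties
open import Algebra.Properties.CommutativeSemigroup using (interchange)
open import Data.Nat.Properties using (*-comm; *-suc; *-commutativeSemigroup)
open import Data.Sum using (inj₁; inj₂)
import Data.Fin.Permutation as P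
open import Relation.Binary.PropositionalEquality as ≡ using (_≡_)
import Relation.Binary.Reasoning.Setoid as SetoidReasoning

^-distribʳ-* : ∀ m n k → (m * n) ^ k ≡ m ^ k * n ^ k
^-distribʳ-* m n zero = ≡.refl
^-distribʳ-* m n (suc k) = ≡.trans (≡.cong (m * n *_) (^-distribʳ-* m n k))
  (interchange *-commutativeSemigroup m n (m ^ k) (n ^ k))

-- Pointwise equality _≈_ unfolds to a function type, from which unification cannot
-- recover the two permutations; wrapping it in a record makes them inferable.  A product
-- x · y also unfolds, so its factors are never inferred and congruences take them explicitly.
infix 4 _≃_
record _≃_ {n : ℕ} (π ρ : Perm n) : Set where
  constructor ≈⇒≃
  field ≃⇒≈ : π ≈ ρ
open _≃_ public

·-⁻¹-isGroup : (n : ℕ) → IsGroup (_≃_ {n}) _·_ id _⁻¹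
·-⁻¹-isGroup n = record
  { isMonoid = record
    { isSemigroup = record
      { isMagma = record
        { isEquivalence = record
          { refl = ≈⇒≃ λ _ → ≡.refl
          ; sym = λ (≈⇒≃ x≈y) → ≈⇒≃ λ i → ≡.sym (x≈y i)
          ; trans = λ (≈⇒≃ x≈y) (≈⇒≃ y≈z) → ≈⇒≃ λ i → ≡.trans (x≈y i) (y≈z i)
          }
        ; ∙-cong = λ {x} (≈⇒≃ x≈y) (≈⇒≃ u≈v) → ≈⇒≃ λ i →
            ≡.trans (≡.cong (x ⟨$⟩ʳ_) (u≈v i)) (x≈y _)
        }
      ; assoc = λ _ _ _ → ≈⇒≃ λ _ → ≡.refl
      }
    ; identity = (λ _ → ≈⇒≃ λ _ → ≡.refl) , (λ _ → ≈⇒≃ λ _ → ≡.refl)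
    }
  ; inverse = (λ x → ≈⇒≃ λ _ → P.inverseˡ x) , (λ x → ≈⇒≃ λ _ → P.inverseʳ x)
  ; ⁻¹-cong = λ {x} {y} (≈⇒≃ x≈y) → ≈⇒≃ λ i →
      ≡.trans (≡.cong (x ⁻¹ ⟨$⟩ʳ_) (≡.trans (≡.sym (P.inverseʳ y)) (≡.sym (x≈y _))))
        (P.inverseˡ x)
  }

Sym : ℕ → Group 0ℓ 0ℓ
Sym n = record { isGroup = ·-⁻¹-isGroup n }

module _ {n : ℕ} where
  open Group (Sym n)
    using (setoid; reflexive; ∙-cong; ⁻¹-cong; ∙-congˡ; ∙-congʳ; assoc; identityˡ; identityʳ)
    renaming (refl to ≃-refl; sym to ≃-sym; trans to ≃-trans)
  open GroupProperties (Sym n) using (quasigroup; inverseʳ-unique; ⁻¹-involutive)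
  open QuasigroupProperties quasigroup using (cancelʳ)
  open SetoidReasoning setoid

  ^-+ : ∀ (x : Perm n) a b → x ^ₚ (a + b) ≃ x ^ₚ a · x ^ₚ b
  ^-+ x zero b = ≃-sym (identityˡ _)
  ^-+ x (suc a) b = begin
    x · x ^ₚ (a + b)       ≈⟨ ∙-congˡ {x} (^-+ x a b) ⟩
    x · (x ^ₚ a · x ^ₚ b)  ≈⟨ assoc x (x ^ₚ a) (x ^ₚ b) ⟨
    x · x ^ₚ a · x ^ₚ b    ∎

  ^-* : ∀ (x : Perm n) a b → x ^ₚ (a * b) ≃ (x ^ₚ a) ^ₚ b
  ^-* x a zero = reflexive (≡.cong (x ^ₚ_) (*-comm a 0))
  ^-* x a (suc b) = begin
    x ^ₚ (a * suc b)          ≡⟨ ≡.cong (x ^ₚ_) (*-suc a b) ⟩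
    x ^ₚ (a + a * b)          ≈⟨ ^-+ x a (a * b) ⟩
    x ^ₚ a · x ^ₚ (a * b)     ≈⟨ ∙-congˡ {x ^ₚ a} (^-* x a b) ⟩
    x ^ₚ a · (x ^ₚ a) ^ₚ b    ∎

  ^-cong : ∀ {x y : Perm n} a → x ≃ y → x ^ₚ a ≃ y ^ₚ a
  ^-cong zero    x≃y = ≃-refl
  ^-cong (suc a) x≃y = ∙-cong x≃y (^-cong a x≃y)

  id-^ : ∀ a → id ^ₚ a ≃ id {n}
  id-^ zero    = ≃-refl
  id-^ (suc a) = ≃-trans (identityˡ (id ^ₚ a)) (id-^ a)

  ^-annihilated : ∀ {x : Perm n} m a → x ^ₚ m ≃ id → x ^ₚ (m * a) ≃ id
  ^-annihilated {x} m a xᵐ≃id = begin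
    x ^ₚ (m * a)   ≈⟨ ^-* x m a ⟩
    (x ^ₚ m) ^ₚ a  ≈⟨ ^-cong a xᵐ≃id ⟩
    id ^ₚ a        ≈⟨ id-^ a ⟩
    id             ∎

  ^-annihilated-^ : ∀ {x : Perm n} m a → x ^ₚ m ≃ id → (x ^ₚ a) ^ₚ m ≃ id
  ^-annihilated-^ {x} m a xᵐ≃id = begin
    (x ^ₚ a) ^ₚ m  ≈⟨ ^-* x a m ⟨
    x ^ₚ (a * m)   ≡⟨ ≡.cong (x ^ₚ_) (*-comm a m) ⟩
    x ^ₚ (m * a)   ≈⟨ ^-annihilated m a xᵐ≃id ⟩
    id             ∎

  conj-· : ∀ (g x y : Perm n) → g ⁻¹ · x · g · (g ⁻¹ · y · g) ≃ g ⁻¹ · (x · y) · g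
  conj-· g x y = ≈⇒≃ λ _ → ≡.cong (λ z → g ⁻¹ ⟨$⟩ʳ (x ⟨$⟩ʳ z)) (P.inverseʳ g)

  ^-conj : ∀ (g x : Perm n) a → (g ⁻¹ · x · g) ^ₚ a ≃ g ⁻¹ · x ^ₚ a · g
  ^-conj g x zero    = ≈⇒≃ λ _ → ≡.sym (P.inverseˡ g)
  ^-conj g x (suc a) = begin
    g ⁻¹ · x · g · (g ⁻¹ · x · g) ^ₚ a  ≈⟨ ∙-congˡ {g ⁻¹ · x · g} (^-conj g x a) ⟩
    g ⁻¹ · x · g · (g ⁻¹ · x ^ₚ a · g)  ≈⟨ conj-· g x (x ^ₚ a) ⟩
    g ⁻¹ · x ^ₚ suc a · g               ∎

  commutes-^ : ∀ {x y : Perm n} a → x · y ≃ y · x → y · x ^ₚ a ≃ x ^ₚ a · y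
  commutes-^ zero xy≃yx = ≈⇒≃ λ _ → ≡.refl
  commutes-^ {x} {y} (suc a) xy≃yx = begin
    y · (x · x ^ₚ a)  ≈⟨ assoc y x (x ^ₚ a) ⟨
    y · x · x ^ₚ a    ≈⟨ ∙-congʳ {x ^ₚ a} xy≃yx ⟨
    x · y · x ^ₚ a    ≈⟨ assoc x y (x ^ₚ a) ⟩
    x · (y · x ^ₚ a)  ≈⟨ ∙-congˡ {x} (commutes-^ {x} {y} a xy≃yx) ⟩
    x · (x ^ₚ a · y)  ≈⟨ assoc x (x ^ₚ a) y ⟨
    x · x ^ₚ a · y    ∎

  ^-distrib-· : ∀ {x y : Perm n} a → x · y ≃ y · x → (x · y) ^ₚ a ≃ x ^ₚ a · y ^ₚ a
  ^-distrib-· zero xy≃yx = ≈⇒≃ λ _ → ≡.refl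
  ^-distrib-· {x} {y} (suc a) xy≃yx = begin
    x · y · (x · y) ^ₚ a          ≈⟨ ∙-congˡ {x · y} (^-distrib-· {x} {y} a xy≃yx) ⟩
    x · y · (x ^ₚ a · y ^ₚ a)     ≈⟨ assoc x y (x ^ₚ a · y ^ₚ a) ⟩
    x · (y · (x ^ₚ a · y ^ₚ a))   ≈⟨ ∙-congˡ {x} (assoc y (x ^ₚ a) (y ^ₚ a)) ⟨
    x · (y · x ^ₚ a · y ^ₚ a)     ≈⟨ ∙-congˡ {x} (∙-congʳ {y ^ₚ a} (commutes-^ {x} {y} a xy≃yx)) ⟩
    x · (x ^ₚ a · y · y ^ₚ a)     ≈⟨ ∙-congˡ {x} (assoc (x ^ₚ a) y (y ^ₚ a)) ⟩
    x · (x ^ₚ a · (y · y ^ₚ a))   ≈⟨ assoc x (x ^ₚ a) (y · y ^ₚ a) ⟨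
    x · x ^ₚ a · (y · y ^ₚ a)     ∎

  ≃-resp : ∀ {H : Subset n} {x y} → IsSubgroup H → x ≃ y → H x → H y
  ≃-resp H≤ x≃y = IsSubgroup.resp H≤ (≃⇒≈ x≃y)

  ^-closed : ∀ {H : Subset n} {x} → IsSubgroup H → ∀ a → H x → H (x ^ₚ a)
  ^-closed H≤ zero    x∈H = IsSubgroup.one H≤
  ^-closed H≤ (suc a) x∈H = IsSubgroup.mul H≤ x∈H (^-closed H≤ a x∈H)

  ⟨⟩-isSubgroup : (S : Subset n) → IsSubgroup ⟨ S ⟩
  ⟨⟩-isSubgroup S = record { resp = resp ; one = one ; mul = mul ; inv = inv }

  ⟨⟩-minimal : ∀ {S G : Subset n} → IsSubgroup G → S ⊆ G → ⟨ S ⟩ ⊆ G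
  ⟨⟩-minimal G≤ S⊆G g (gen g∈S)   = S⊆G g g∈S
  ⟨⟩-minimal G≤ S⊆G _ one         = IsSubgroup.one G≤
  ⟨⟩-minimal G≤ S⊆G _ (mul g∈ h∈) =
    IsSubgroup.mul G≤ (⟨⟩-minimal G≤ S⊆G _ g∈) (⟨⟩-minimal G≤ S⊆G _ h∈)
  ⟨⟩-minimal G≤ S⊆G _ (inv g∈)    = IsSubgroup.inv G≤ (⟨⟩-minimal G≤ S⊆G _ g∈)
  ⟨⟩-minimal G≤ S⊆G _ (resp e g∈) = IsSubgroup.resp G≤ e (⟨⟩-minimal G≤ S⊆G _ g∈)

  ′-⊆ : ∀ {G : Subset n} → IsSubgroup G → (G ′) ⊆ G
  ′-⊆ {G} G≤ = ⟨⟩-minimal G≤ commutator∈G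
    where
    module G = IsSubgroup G≤
    commutator∈G : Commutators G ⊆ G
    commutator∈G g (a , b , a∈G , b∈G , g≈[a,b]) =
      ≃-resp G≤ (≃-sym (≈⇒≃ g≈[a,b])) (G.mul (G.mul (G.mul (G.inv a∈G) (G.inv b∈G)) a∈G) b∈G)

  Powers : Perm n → Subset n
  Powers c x = Σ ℕ λ i → x ≃ c ^ₚ i

  Powers-isSubgroup : ∀ {c : Perm n} {m} → 0 < m → c ^ₚ m ≃ id → IsSubgroup (Powers c)
  Powers-isSubgroup {c} {suc m} _ cᵐ≃id = record
    { resp = λ x≈y (i , x≃cⁱ) → i , ≃-trans (≃-sym (≈⇒≃ x≈y)) x≃cⁱ
    ; one  = 0 , ≃-refl
    ; mul  = λ (i , x≃cⁱ) (j , y≃cʲ) → i + j , ≃-trans (∙-cong x≃cⁱ y≃cʲ) (≃-sym (^-+ c i j))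
    ; inv  = λ (i , x≃cⁱ) → i * m ,
        ≃-trans (⁻¹-cong x≃cⁱ) (≃-sym (inverseʳ-unique (c ^ₚ i) (c ^ₚ (i * m)) (cⁱ·cⁱᵐ≃id i)))
    }
    where
    cⁱ·cⁱᵐ≃id : ∀ i → c ^ₚ i · c ^ₚ (i * m) ≃ id
    cⁱ·cⁱᵐ≃id i = begin
      c ^ₚ i · c ^ₚ (i * m)  ≈⟨ ^-+ c i (i * m) ⟨
      c ^ₚ (i + i * m)       ≡⟨ ≡.cong (c ^ₚ_) (≡.trans (≡.sym (*-suc i m)) (*-comm i (suc m))) ⟩
      c ^ₚ (suc m * i)       ≈⟨ ^-annihilated (suc m) i cᵐ≃id ⟩
      id                     ∎

  Powers-^-isSubgroup : ∀ {c : Perm n} m a → 0 < m → c ^ₚ m ≃ id → IsSubgroup (Powers (c ^ₚ a))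
  Powers-^-isSubgroup m a 0<m cᵐ≃id = Powers-isSubgroup 0<m (^-annihilated-^ m a cᵐ≃id)

  Powers-minimal : ∀ {H : Subset n} {c} → IsSubgroup H → H c → Powers c ⊆ H
  Powers-minimal H≤ c∈H x (i , x≃cⁱ) = ≃-resp H≤ (≃-sym x≃cⁱ) (^-closed H≤ i c∈H)

  Powers-^ : ∀ {c x : Perm n} p → Powers c x → Powers (c ^ₚ p) (x ^ₚ p)
  Powers-^ {c} {x} p (i , x≃cⁱ) = i , (begin
    x ^ₚ p          ≈⟨ ^-cong p x≃cⁱ ⟩
    (c ^ₚ i) ^ₚ p   ≈⟨ ^-* c i p ⟨
    c ^ₚ (i * p)    ≡⟨ ≡.cong (c ^ₚ_) (*-comm i p) ⟩
    c ^ₚ (p * i)    ≈⟨ ^-* c p i ⟩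
    (c ^ₚ p) ^ₚ i   ∎)

  ^ˢ-⊆-Powers : ∀ {H : Subset n} {c} p → IsSubgroup (Powers (c ^ₚ p)) → H ⊆ Powers c →
    (H ^ˢ p) ⊆ Powers (c ^ₚ p)
  ^ˢ-⊆-Powers p ⟨cᵖ⟩≤ H⊆⟨c⟩ = ⟨⟩-minimal ⟨cᵖ⟩≤ λ g (h , h∈H , g≈hᵖ) →
    ≃-resp ⟨cᵖ⟩≤ (≃-sym (≈⇒≃ g≈hᵖ)) (Powers-^ p (H⊆⟨c⟩ h h∈H))

  Powers-^-⊆ : ∀ {c : Perm n} p → Powers (c ^ₚ p) ⊆ Powers c
  Powers-^-⊆ {c} p x (j , x≃cᵖʲ) = p * j , ≃-trans x≃cᵖʲ (≃-sym (^-* c p j))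

  _Normalises_ : Subset n → Subset n → Set
  K Normalises N = ∀ g w → K g → N w → N (g ⁻¹ · w · g)

  conj-Powers : ∀ (g c : Perm n) {x} e i → g ⁻¹ · c · g ≃ c ^ₚ e → x ≃ c ^ₚ i →
    g ⁻¹ · x · g ≃ x ^ₚ e
  conj-Powers g c {x} e i conj x≃cⁱ = begin
    g ⁻¹ · x · g         ≈⟨ ∙-congʳ {g} (∙-congˡ {g ⁻¹} x≃cⁱ) ⟩
    g ⁻¹ · c ^ₚ i · g    ≈⟨ ^-conj g c i ⟨
    (g ⁻¹ · c · g) ^ₚ i  ≈⟨ ^-cong i conj ⟩
    (c ^ₚ e) ^ₚ i        ≈⟨ ^-* c e i ⟨
    c ^ₚ (e * i)         ≡⟨ ≡.cong (c ^ₚ_) (*-comm e i) ⟩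
    c ^ₚ (i * e)         ≈⟨ ^-* c i e ⟩
    (c ^ₚ i) ^ₚ e        ≈⟨ ^-cong e x≃cⁱ ⟨
    x ^ₚ e               ∎

  normalises-⊆-Powers : ∀ {G H : Subset n} {c} → IsSubgroup H → H ⊆ Powers c →
    G Normalises Powers c → G Normalises H
  normalises-⊆-Powers {c = c} H≤ H⊆⟨c⟩ G↻⟨c⟩ g h g∈G h∈H
    with G↻⟨c⟩ g c g∈G (1 , ≃-sym (identityʳ c)) | H⊆⟨c⟩ h h∈H
  ... | e , conj | i , h≃cⁱ = ≃-resp H≤ (≃-sym (conj-Powers g c e i conj h≃cⁱ)) (^-closed H≤ e h∈H)

  normalises⇒NormalIn : ∀ {G H : Subset n} → IsSubgroup G → IsSubgroup H →
    G Normalises H → NormalIn H G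
  normalises⇒NormalIn G≤ H≤ G↻H g h g∈G h∈H =
    ≃-resp H≤ (∙-congʳ {g ⁻¹} (∙-congʳ {h} (⁻¹-involutive g)))
      (G↻H (g ⁻¹) h (IsSubgroup.inv G≤ g∈G) h∈H)

  conj≃·commutator : ∀ (c g : Perm n) → g ⁻¹ · c · g ≃ c · [ c , g ]
  conj≃·commutator c g = ≈⇒≃ λ _ → ≡.sym (P.inverseʳ c)

  ′-⊆-Powers⇒normalises : ∀ {G : Subset n} {c} → G c → (G ′) ⊆ Powers c → G Normalises Powers c
  ′-⊆-Powers⇒normalises {c = c} c∈G G′⊆⟨c⟩ g w g∈G (i , w≃cⁱ)
    with G′⊆⟨c⟩ [ c , g ] (gen (c , g , c∈G , g∈G , λ _ → ≡.refl))
  ... | j , [c,g]≃cʲ = i * suc j , (begin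
    g ⁻¹ · w · g        ≈⟨ conj-Powers g c (suc j) i g⁻¹cg≃cʲ⁺¹ w≃cⁱ ⟩
    w ^ₚ suc j          ≈⟨ ^-cong (suc j) w≃cⁱ ⟩
    (c ^ₚ i) ^ₚ suc j   ≈⟨ ^-* c i (suc j) ⟨
    c ^ₚ (i * suc j)    ∎)
    where
    g⁻¹cg≃cʲ⁺¹ : g ⁻¹ · c · g ≃ c ^ₚ suc j
    g⁻¹cg≃cʲ⁺¹ = ≃-trans (conj≃·commutator c g) (∙-congˡ {c} [c,g]≃cʲ)

  _⊙_ : Subset n → Subset n → Subset n
  (K ⊙ N) y = Σ (Perm n) λ k → Σ (Perm n) λ w → K k × N w × y ≃ k · w

  ⊙-isSubgroup : ∀ {K N : Subset n} → IsSubgroup K → IsSubgroup N → K Normalises N →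
    IsSubgroup (K ⊙ N)
  ⊙-isSubgroup K≤ N≤ K↻N = record
    { resp = λ x≈y (k , w , k∈K , w∈N , x≃kw) → k , w , k∈K , w∈N , ≃-trans (≃-sym (≈⇒≃ x≈y)) x≃kw
    ; one  = id , id , K.one , N.one , ≈⇒≃ λ _ → ≡.refl
    ; mul  = λ (k₁ , w₁ , k₁∈K , w₁∈N , x≃k₁w₁) (k₂ , w₂ , k₂∈K , w₂∈N , y≃k₂w₂) →
        k₁ · k₂ , k₂ ⁻¹ · w₁ · k₂ · w₂ , K.mul k₁∈K k₂∈K , N.mul (K↻N k₂ w₁ k₂∈K w₁∈N) w₂∈N ,
        ≃-trans (∙-cong x≃k₁w₁ y≃k₂w₂)
          (≈⇒≃ λ _ → ≡.cong (k₁ ⟨$⟩ʳ_) (≡.sym (P.inverseʳ k₂)))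
    ; inv  = λ (k , w , k∈K , w∈N , x≃kw) →
        k ⁻¹ , k ⁻¹ ⁻¹ · w ⁻¹ · k ⁻¹ , K.inv k∈K , K↻N (k ⁻¹) (w ⁻¹) (K.inv k∈K) (N.inv w∈N) ,
        ≃-trans (⁻¹-cong x≃kw) (≈⇒≃ λ _ → ≡.sym (P.inverseˡ k))
    }
    where
    module K = IsSubgroup K≤
    module N = IsSubgroup N≤

  factor-commutes : ∀ {x y k : Perm n} → x · y ≃ y · x → x ≃ k · y → k · y ≃ y · k
  factor-commutes {x} {y} {k} xy≃yx x≃ky = cancelʳ y (k · y) (y · k) (begin
    k · y · y    ≈⟨ ∙-congʳ {y} x≃ky ⟨
    x · y        ≈⟨ xy≃yx ⟩
    y · x        ≈⟨ ∙-congˡ {y} x≃ky ⟩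
    y · (k · y)  ≈⟨ assoc y k y ⟨
    y · k · y    ∎)

  cofactor-power-factorisation : ∀ {c h : Perm n} q → c ≃ h · c ^ₚ q →
    ∀ r → Σ ℕ λ a → c ≃ h ^ₚ a · c ^ₚ (q ^ r)
  cofactor-power-factorisation         q c≃h·cq zero    = 0 , ≈⇒≃ λ _ → ≡.refl
  cofactor-power-factorisation {c} {h} q c≃h·cq (suc r)
    with cofactor-power-factorisation q c≃h·cq r
  ... | a , c≃hᵃ·cq^r = a + q ^ r , (begin
    c                                              ≈⟨ c≃hᵃ·cq^r ⟩
    h ^ₚ a · c ^ₚ (q ^ r)                          ≈⟨ ∙-congˡ {h ^ₚ a} (^-cong (q ^ r) c≃h·cq) ⟩
    h ^ₚ a · (h · c ^ₚ q) ^ₚ (q ^ r)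
      ≈⟨ ∙-congˡ {h ^ₚ a} (^-distrib-· {h} {c ^ₚ q} (q ^ r) h·cq-commute) ⟩
    h ^ₚ a · (h ^ₚ (q ^ r) · (c ^ₚ q) ^ₚ (q ^ r))
      ≈⟨ ∙-congˡ {h ^ₚ a} (∙-congˡ {h ^ₚ (q ^ r)} (^-* c q (q ^ r))) ⟨
    h ^ₚ a · (h ^ₚ (q ^ r) · c ^ₚ (q ^ suc r))
      ≈⟨ assoc (h ^ₚ a) (h ^ₚ (q ^ r)) (c ^ₚ (q ^ suc r)) ⟨
    h ^ₚ a · h ^ₚ (q ^ r) · c ^ₚ (q ^ suc r)       ≈⟨ ∙-congʳ {c ^ₚ (q ^ suc r)} (^-+ h a (q ^ r)) ⟨
    h ^ₚ (a + q ^ r) · c ^ₚ (q ^ suc r)            ∎)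
    where
    h·cq-commute : h · c ^ₚ q ≃ c ^ₚ q · h
    h·cq-commute = factor-commutes {c} {c ^ₚ q} {h} (commutes-^ {c} {c} q ≃-refl) c≃h·cq

  power-of-cofactor : ∀ {c h : Perm n} q r → c ≃ h · c ^ₚ q → c ^ₚ (q ^ r) ≃ id → Powers h c
  power-of-cofactor {c} {h} q r c≃h·cq cq^r≃id with cofactor-power-factorisation q c≃h·cq r
  ... | a , c≃hᵃ·cq^r = a , (begin
    c                      ≈⟨ c≃hᵃ·cq^r ⟩
    h ^ₚ a · c ^ₚ (q ^ r)  ≈⟨ ∙-congˡ {h ^ₚ a} cq^r≃id ⟩
    h ^ₚ a · id            ≈⟨ identityʳ (h ^ₚ a) ⟩
    h ^ₚ a                 ∎)

  ⊙-Powers-^-⊆ : ∀ {K : Subset n} {c} p k → IsSubgroup K → c ^ₚ (p ^ k) ≃ id →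
    (K ⊙ Powers (c ^ₚ p)) c → (K ⊙ Powers (c ^ₚ p)) ⊆ K
  ⊙-Powers-^-⊆ {K} {c} p k K≤ cᵖᵏ≃id (h , w , h∈K , (j , w≃cᵖʲ) , c≃hw)
    x (h′ , w′ , h′∈K , w′∈⟨cᵖ⟩ , x≃h′w′) =
    ≃-resp K≤ (≃-sym x≃h′w′)
      (IsSubgroup.mul K≤ h′∈K (Powers-minimal K≤ (^-closed K≤ p c∈K) w′ w′∈⟨cᵖ⟩))
    where
    c≃h·cᵖʲ : c ≃ h · c ^ₚ (p * j)
    c≃h·cᵖʲ = ≃-trans c≃hw (∙-congˡ {h} (≃-trans w≃cᵖʲ (≃-sym (^-* c p j))))
    cᵖʲ^k≃id : c ^ₚ ((p * j) ^ k) ≃ id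
    cᵖʲ^k≃id = ≃-trans (reflexive (≡.cong (c ^ₚ_) (^-distribʳ-* p j k)))
      (^-annihilated (p ^ k) (j ^ k) cᵖᵏ≃id)
    c∈K : K c
    c∈K = Powers-minimal K≤ h∈K c (power-of-cofactor (p * j) k c≃h·cᵖʲ cᵖʲ^k≃id)

  Powers-^-⊆Φ : ∀ {G : Subset n} {c} p k → IsSubgroup G → G c → G Normalises Powers c →
    0 < p ^ k → c ^ₚ (p ^ k) ≃ id → Powers (c ^ₚ p) ⊆Φ G
  Powers-^-⊆Φ {G} {c} p k G≤ c∈G G↻⟨c⟩ 0<pᵏ cᵖᵏ≃id x x∈⟨cᵖ⟩ =
    Powers-minimal G≤ (^-closed G≤ p c∈G) x x∈⟨cᵖ⟩ , ⟨S⟩≐G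
    where
    ⟨cᵖ⟩≤ : IsSubgroup (Powers (c ^ₚ p))
    ⟨cᵖ⟩≤ = Powers-^-isSubgroup (p ^ k) p 0<pᵏ cᵖᵏ≃id

    ⟨S⟩≐G : (S : Subset n) → S ⊆ G → ⟨ S ∪ ⟦ x ⟧ ⟩ ≐ G → ⟨ S ⟩ ≐ G
    ⟨S⟩≐G S S⊆G (_ , G⊆⟨S,x⟩) = ⟨⟩-minimal G≤ S⊆G , λ g g∈G →
      ⊙-Powers-^-⊆ p k (⟨⟩-isSubgroup S) cᵖᵏ≃id (G⊆⟨S⟩⊙⟨cᵖ⟩ c c∈G) g (G⊆⟨S⟩⊙⟨cᵖ⟩ g g∈G)
      where
      ⟨S⟩↻⟨cᵖ⟩ : ⟨ S ⟩ Normalises Powers (c ^ₚ p)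
      ⟨S⟩↻⟨cᵖ⟩ g w g∈⟨S⟩ =
        normalises-⊆-Powers ⟨cᵖ⟩≤ (Powers-^-⊆ p) G↻⟨c⟩ g w (⟨⟩-minimal G≤ S⊆G g g∈⟨S⟩)
      generators⊆ : (S ∪ ⟦ x ⟧) ⊆ (⟨ S ⟩ ⊙ Powers (c ^ₚ p))
      generators⊆ y (inj₁ y∈S) = y , id , gen y∈S , IsSubgroup.one ⟨cᵖ⟩≤ , ≈⇒≃ λ _ → ≡.refl
      generators⊆ y (inj₂ y≈x) = id , x , one , x∈⟨cᵖ⟩ , ≈⇒≃ y≈x
      G⊆⟨S⟩⊙⟨cᵖ⟩ : G ⊆ (⟨ S ⟩ ⊙ Powers (c ^ₚ p))
      G⊆⟨S⟩⊙⟨cᵖ⟩ g g∈G =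
        ⟨⟩-minimal (⊙-isSubgroup (⟨⟩-isSubgroup S) ⟨cᵖ⟩≤ ⟨S⟩↻⟨cᵖ⟩) generators⊆ g (G⊆⟨S,x⟩ g g∈G)

lemma3p4 : (n : ℕ) (X : Graph n) → 3 ≤ n → Connected X → VertexTransitive X →
    (G : Subset n) → IsAutGroup X G → Transitive G →
    (p k : ℕ) → Prime p → CyclicOfOrder (G ′) (p ^ k) → GMinimal X G →
    (H : Subset n) → IsSubgroup H → H ⊆ (G ′) →
    NormalIn H G × ((H ^ˢ p) ⊆Φ G)
lemma3p4 _ _ _ _ _ G (G≤ , _) _ p k _ (c , c∈G′ , (G′⊆⟨c⟩ , _) , 0<pᵏ , cᵖᵏ≈id , _) _ H H≤ H⊆G′ =
  normalises⇒NormalIn G≤ H≤ (normalises-⊆-Powers H≤ H⊆Powers G↻⟨c⟩) ,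
  λ x x∈Hᵖ → Powers-^-⊆Φ p k G≤ c∈G G↻⟨c⟩ 0<pᵏ cᵖᵏ≃id x
    (^ˢ-⊆-Powers p (Powers-^-isSubgroup (p ^ k) p 0<pᵏ cᵖᵏ≃id) H⊆Powers x x∈Hᵖ)
  where
  cᵖᵏ≃id : c ^ₚ (p ^ k) ≃ id
  cᵖᵏ≃id = ≈⇒≃ cᵖᵏ≈id
  c∈G : G c
  c∈G = ′-⊆ G≤ c c∈G′
  G′⊆Powers : (G ′) ⊆ Powers c
  G′⊆Powers g g∈G′ =
    ⟨⟩-minimal (Powers-isSubgroup 0<pᵏ cᵖᵏ≃id) (λ g g≈c → 1 , ≈⇒≃ g≈c) g (G′⊆⟨c⟩ g g∈G′)
  H⊆Powers : H ⊆ Powers c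
  H⊆Powers h h∈H = G′⊆Powers h (H⊆G′ h h∈H)
  G↻⟨c⟩ : G Normalises Powers c
  G↻⟨c⟩ = ′-⊆-Powers⇒normalises c∈G G′⊆Powers
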